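{- Let $n\ge 3$. If $\pi_1,\pi_2\in S_n$ have the same number of fixed points, then $G_{\pi_1}\approx G_{\pi_2}$.
   Context: $S_n$ is the symmetric group on $\{1,\dots,n\}$; a fixed point of $\pi$ is $i$ with $\pi(i)=i$. Fix disjoint vertex sets $A=\{a_1,\dots,a_n\}$, $B=\{b_1,\dots,b_n\}$, $C=\{c_1,\dots,c_n\}$, $D=\{d_1,\dots,d_n\}$. For $\pi\in S_n$, $G^-_\pi$ is the graph on $A\cup B\cup C\cup D$ with edges $\{a_i,b_j\}$ ($i\ne j$), $\{b_i,c_i\}$ (all $i$), $\{c_i,d_j\}$ ($i\ne j$), and $\{a_i,d_{\pi(i)}\}$ (all $i$). $G_\pi$ is obtained from $G^-_\pi$ by adding three new vertices $e,f,g$ with neighbourhoods $N(e)=B\cup D\cup\{f,g\}$, $N(f)=A\cup C\cup\{e\}$, $N(g)=C\cup\{e\}$. For a vertex set $S$, $N(S)$ is the set of vertices adjacent to some vertex of $S$. Two connected bipartite graphs $G,H$ are neighbourhood size equivalent, $G\approx H$, if there are bipartitions $(X^G,Y^G)$ of $G$ and $(X^H,Y^H)$ of $H$ with $|X^G|\le|Y^G|$, $|X^H|\le|Y^H|$, $|X^G|=|X^H|$, $|Y^G|=|Y^H|$, and a bijection $\eta$ from the power set of $X^G$ to the power set of $X^H$ such that for every $S\subseteq X^G$: $|\eta(S)|=|S|$ and $|N(\eta(S))| = |N(S)|$. -}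

module Defs where

open import Data.Nat using (ℕ; zero; suc; _+_; _≤_)
open import Data.Bool using (Bool; true; false; _∧_; not)
open import Data.Fin using (Fin; zero; suc; splitAt; _≟_)
open import Data.Fin.Subset using (Subset; _⊆_; _∉_; _∈_; ∁; ∣_∣)
open import Data.Fin.Permutation using (Permutation′; _⟨$⟩ʳ_)
open import Data.Vec using (tabulate; lookup)
open import Data.List using (List; length; filter; allFin)
open import Data.Bool.ListAction using (any)
open import Data.Product using (_×_; ∃)
open import Data.Sum using (_⊎_; inj₁; inj₂)
open import Relation.Nullary.Decidable using (⌊_⌋)
open import Relation.Binary.PropositionalEquality using (_≡_)
open import Relation.Binary.Construct.Closure.ReflexiveTransitive using (Star)

Graph : ℕ → Set
Graph m = Fin m → Fin m → Bool

Adj : ∀ {m} → Graph m → Fin m → Fin m → Set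
Adj G u v = G u v ≡ true

Connected : ∀ {m} → Graph m → Set
Connected G = ∀ u v → Star (Adj G) u v

IsBipartition : ∀ {m} → Graph m → Subset m → Set
IsBipartition G X =
  ∀ u v → Adj G u v → (u ∈ X × v ∉ X) ⊎ (u ∉ X × v ∈ X)

N : ∀ {m} → Graph m → Subset m → Subset m
N {m} G S = tabulate (λ v → any (λ u → lookup S u ∧ G u v) (allFin m))

-- X plays the role of X^G, its complement ∁ X the role of Y^G (same for H).
-- η is a bijection from the subsets of X to the subsets of X'
-- (written out: maps into, injective on, and onto).
_≈_ : ∀ {m m'} → Graph m → Graph m' → Set
_≈_ {m} {m'} G H =
  Connected G × Connected H ×
  ∃ λ (X : Subset m) → ∃ λ (X' : Subset m') →
    IsBipartition G X × IsBipartition H X' ×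
    ∣ X ∣ ≤ ∣ ∁ X ∣ × ∣ X' ∣ ≤ ∣ ∁ X' ∣ ×
    ∣ X ∣ ≡ ∣ X' ∣ × ∣ ∁ X ∣ ≡ ∣ ∁ X' ∣ ×
    ∃ λ (η : Subset m → Subset m') →
      (∀ S → S ⊆ X → η S ⊆ X') ×
      (∀ S S' → S ⊆ X → S' ⊆ X → η S ≡ η S' → S ≡ S') ×
      (∀ T → T ⊆ X' → ∃ λ S → S ⊆ X × η S ≡ T) ×
      (∀ S → S ⊆ X → ∣ η S ∣ ≡ ∣ S ∣ × ∣ N H (η S) ∣ ≡ ∣ N G S ∣)

fixedPoints : ∀ {n} → Permutation′ n → ℕ
fixedPoints {n} π = length (filter (λ i → π ⟨$⟩ʳ i ≟ i) (allFin n))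

data Vtx (n : ℕ) : Set where
  a b c d : Fin n → Vtx n
  e f g : Vtx n

_==_ : ∀ {n} → Fin n → Fin n → Bool
i == j = ⌊ i ≟ j ⌋

adjV : ∀ {n} → Permutation′ n → Vtx n → Vtx n → Bool
adjV π (a i) (b j) = not (i == j)
adjV π (b j) (a i) = not (i == j)
adjV π (b i) (c j) = i == j
adjV π (c j) (b i) = i == j
adjV π (c i) (d j) = not (i == j)
adjV π (d j) (c i) = not (i == j)
adjV π (a i) (d j) = (π ⟨$⟩ʳ i) == j
adjV π (d j) (a i) = (π ⟨$⟩ʳ i) == j
adjV π e (b j) = true
adjV π (b j) e = true
adjV π e (d j) = true
adjV π (d j) e = true
adjV π e f = true
adjV π f e = true
adjV π e g = true
adjV π g e = true
adjV π f (a i) = true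
adjV π (a i) f = true
adjV π f (c i) = true
adjV π (c i) f = true
adjV π g (c i) = true
adjV π (c i) g = true
adjV π _ _ = false

nV : ℕ → ℕ
nV n = n + (n + (n + (n + 3)))

decode : ∀ n → Fin (nV n) → Vtx n
decode n i with splitAt n i
... | inj₁ x = a x
... | inj₂ i₁ with splitAt n i₁
...   | inj₁ x = b x
...   | inj₂ i₂ with splitAt n i₂
...     | inj₁ x = c x
...     | inj₂ i₃ with splitAt n i₃
...       | inj₁ x = d x
...       | inj₂ zero = e
...       | inj₂ (suc zero) = f
...       | inj₂ (suc (suc zero)) = g

Gπ : ∀ {n} → Permutation′ n → Graph (nV n)
Gπ {n} π u v = adjV π (decode n u) (decode n v)

-- Take X = A ∪ C ∪ {e} as the smaller side (2n + 1 against 2n + 2 vertices).  A subset S of X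
-- is a triple (I , J , e?) with I, J ⊆ {1..n} and e? = [e ∈ S], and π enters N(S) only through
-- the D-block: d_k ∈ N(S) iff π⁻¹ k ∈ I, or J ∖ {k} ≠ ∅, or e?.  So |N(S)| depends on π only
-- through π⁻¹ j when J = {j} (for J = ∅ the D-block is a permuted copy of I, or all of D).
-- Conjugating π by α is a graph isomorphism; choose α carrying the fixed points of π₂ onto those
-- of π₁, so that π₁ and π₃ = α⁻¹π₂α fix the same points.  For J = {j} the transposition θ of
-- π₁⁻¹ j and π₃⁻¹ j then fixes j, and (I , J , e?) ↦ (θ I , J , e?), followed by relabelling
-- with α, carries neighbourhood sizes in G_π₁ to those in G_π₂.
module Submission where

open import Defs
open import Data.Nat using (ℕ; _≤_)
open import Data.Fin.Permutation using (Permutation′)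
open import Relation.Binary.PropositionalEquality using (_≡_)

open import Algebra.Bundles using (Monoid; CommutativeMonoid)
import Algebra.Properties.CommutativeMonoid.Sum as CommutativeMonoidSum
import Algebra.Properties.Monoid.Sum as MonoidSum
open import Data.Bool using (Bool; true; false; _∧_; _∨_; not; if_then_else_)
open import Data.Bool.ListAction using () renaming (any to anyᴸ)
open import Data.Bool.Properties
  using (¬-not; ∨-commutativeMonoid; ∨-identityʳ; ∨-zeroʳ; ∧-identityʳ; ∧-zeroʳ; not-involutive)
  renaming (_≟_ to _≟ᵇ_)
open import Data.Fin using (Fin; zero; suc; _↑ˡ_; _↑ʳ_; _≟_; splitAt)
open import Data.Fin.Properties
  using (any?; suc-injective; splitAt-↑ˡ; splitAt-↑ʳ; splitAt⁻¹-↑ˡ; splitAt⁻¹-↑ʳ)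
open import Data.Fin.Permutation
  using (_⟨$⟩ʳ_; _⟨$⟩ˡ_; inverseʳ; inverseˡ; id; flip; _∘ₚ_; lift₀; transpose)
import Data.Fin.Permutation.Components as PC
open import Data.Fin.Subset using (Subset; ∣_∣; ∁; _∈_; _∉_; _⊆_; ⁅_⁆)
open import Data.Fin.Subset.Properties using (x∈⁅x⁆; x∈⁅y⁆⇒x≡y; ⊆-antisym; nonempty?)
open import Data.List using (allFin; length; filter)
import Data.List as List
open import Data.Nat using (zero; suc; _+_; _<_; s≤s; z≤n)
open import Data.Nat.Properties
  using (module ≤-Reasoning; +-0-commutativeMonoid; +-identityʳ; +-suc; +-cancelˡ-≡; +-monoʳ-≤;
         n≤1+n; <-≤-trans; m≤n+m)
open import Data.Product using (∃; _×_; _,_; proj₁; proj₂; uncurry)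
open import Data.Sum using (_⊎_; inj₁; inj₂)
open import Data.Vec using (Vec; tabulate; lookup)
open import Data.Vec.Properties
  using (≡-dec; lookup-replicate; tabulate∘lookup; tabulate-cong; lookup∘tabulate; lookup-map;
         []=⇒lookup; lookup⇒[]=)
open import Function using (_∘_; _⇔_; mk⇔; _↔_; mk↔ₛ′; Inverse)
open import Function.Construct.Composition using (_↔-∘_)
open import Level using (0ℓ)
open import Relation.Binary.Construct.Closure.ReflexiveTransitive using (Star; ε; _◅_; _◅◅_)
open import Relation.Binary.PropositionalEquality
  using (refl; sym; trans; cong; cong₂; subst; subst₂; _≗_; module ≡-Reasoning)
open import Relation.Nullary using (¬_; Dec; yes; no; contradiction)
open import Relation.Nullary.Decidable using (⌊_⌋; dec-true; dec-false; does-⇔; isYes≗does)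
open import Relation.Unary using (Pred; Decidable)

-- Counting over Fin n

module ℕ-Sum = CommutativeMonoidSum +-0-commutativeMonoid
module Bool-Sum = CommutativeMonoidSum ∨-commutativeMonoid

fromBool : Bool → ℕ
fromBool x = if x then 1 else 0

count : ∀ {n} → (Fin n → Bool) → ℕ
count φ = ℕ-Sum.sum (fromBool ∘ φ)

any : ∀ {n} → (Fin n → Bool) → Bool
any = Bool-Sum.sum

count-cong : ∀ {n} {φ ψ : Fin n → Bool} → φ ≗ ψ → count φ ≡ count ψ
count-cong φ≗ψ = ℕ-Sum.sum-cong-≗ (cong fromBool ∘ φ≗ψ)

any-cong : ∀ {n} {φ ψ : Fin n → Bool} → φ ≗ ψ → any φ ≡ any ψ
any-cong = Bool-Sum.sum-cong-≗

count-permute : ∀ {n} (φ : Fin n → Bool) (σ : Permutation′ n) → count (φ ∘ (σ ⟨$⟩ʳ_)) ≡ count φ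
count-permute φ σ = sym (ℕ-Sum.sum-permute (fromBool ∘ φ) σ)

any-permute : ∀ {n} (φ : Fin n → Bool) (σ : Permutation′ n) → any (φ ∘ (σ ⟨$⟩ʳ_)) ≡ any φ
any-permute φ σ = sym (Bool-Sum.sum-permute φ σ)

count-false : ∀ n → count {n} (λ _ → false) ≡ 0
count-false = ℕ-Sum.sum-replicate-zero

any-false : ∀ n → any {n} (λ _ → false) ≡ false
any-false = Bool-Sum.sum-replicate-zero

count-true : ∀ n → count {n} (λ _ → true) ≡ n
count-true zero    = refl
count-true (suc n) = cong suc (count-true n)

count-not : ∀ {n} (φ : Fin n → Bool) → count φ + count (not ∘ φ) ≡ n
count-not {zero}  φ = refl
count-not {suc n} φ with φ zero
... | true  = cong suc (count-not (φ ∘ suc))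
... | false = trans (+-suc _ _) (cong suc (count-not (φ ∘ suc)))

true⇒0<count : ∀ {n} (φ : Fin n → Bool) i → φ i ≡ true → 0 < count φ
true⇒0<count φ zero    φ0 rewrite φ0 = s≤s z≤n
true⇒0<count φ (suc i) φi = <-≤-trans (true⇒0<count (φ ∘ suc) i φi) (m≤n+m _ (fromBool (φ zero)))

0<count⇒true : ∀ {n} (φ : Fin n → Bool) → 0 < count φ → ∃ λ i → φ i ≡ true
0<count⇒true {suc n} φ pos with φ zero in φ0
... | true  = zero , φ0
... | false = let (i , φi) = 0<count⇒true (φ ∘ suc) pos in suc i , φi

count-≡⇒∃true : ∀ {n} (φ ψ : Fin n → Bool) → count φ ≡ count ψ → ∀ i → φ i ≡ true →
                ∃ λ k → ψ k ≡ true
count-≡⇒∃true φ ψ φ≡ψ i φi = 0<count⇒true ψ (subst (0 <_) φ≡ψ (true⇒0<count φ i φi))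

count-≡-not : ∀ {n} (φ ψ : Fin n → Bool) → count φ ≡ count ψ → count (not ∘ φ) ≡ count (not ∘ ψ)
count-≡-not φ ψ φ≡ψ =
  +-cancelˡ-≡ (count φ) _ _ (trans (count-not φ) (sym (trans (cong (_+ _) φ≡ψ) (count-not ψ))))

count-≡⇒∃value : ∀ {n} (φ ψ : Fin n → Bool) → count φ ≡ count ψ → ∀ i → ∃ λ k → ψ k ≡ φ i
count-≡⇒∃value φ ψ φ≡ψ i with φ i in φi
... | true  = count-≡⇒∃true φ ψ φ≡ψ i φi
... | false with count-≡⇒∃true (not ∘ φ) (not ∘ ψ) (count-≡-not φ ψ φ≡ψ) i (cong not φi)
...   | k , ¬ψk = k , trans (sym (not-involutive (ψ k))) (cong not ¬ψk)

count-tail : ∀ {n} (φ ψ : Fin (suc n) → Bool) → count φ ≡ count ψ → φ zero ≡ ψ zero →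
             count (φ ∘ suc) ≡ count (ψ ∘ suc)
count-tail φ ψ φ≡ψ heads =
  +-cancelˡ-≡ (fromBool (φ zero)) _ _ (trans φ≡ψ (cong (λ x → fromBool x + count (ψ ∘ suc)) (sym heads)))

true⇒any : ∀ {n} (φ : Fin n → Bool) i → φ i ≡ true → any φ ≡ true
true⇒any φ zero    φ0 rewrite φ0 = refl
true⇒any φ (suc i) φi rewrite true⇒any (φ ∘ suc) i φi = ∨-zeroʳ (φ zero)

∨-true : ∀ x {y} → y ≡ true → x ∨ y ≡ true
∨-true x refl = ∨-zeroʳ x

==-⇔ : ∀ {n m} {i j : Fin n} {k l : Fin m} → i ≡ j ⇔ k ≡ l → (i == j) ≡ (k == l)
==-⇔ {i = i} {j} {k} {l} i≡j⇔k≡l =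
  trans (isYes≗does (i ≟ j)) (trans (does-⇔ i≡j⇔k≡l (i ≟ j) (k ≟ l)) (sym (isYes≗does (k ≟ l))))

==-refl : ∀ {n} (i : Fin n) → (i == i) ≡ true
==-refl i = trans (isYes≗does (i ≟ i)) (dec-true (i ≟ i) refl)

==⇒≡ : ∀ {n} {i j : Fin n} → (i == j) ≡ true → i ≡ j
==⇒≡ {i = i} {j} _ with i ≟ j
... | yes i≡j = i≡j

≢⇒==false : ∀ {n} {i j : Fin n} → ¬ i ≡ j → (i == j) ≡ false
≢⇒==false {i = i} {j} i≢j = trans (isYes≗does (i ≟ j)) (dec-false (i ≟ j) i≢j)

==-permute : ∀ {n} (σ : Permutation′ n) (i j : Fin n) → ((σ ⟨$⟩ʳ i) == (σ ⟨$⟩ʳ j)) ≡ (i == j)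
==-permute σ i j = ==-⇔ (mk⇔ injective (cong (σ ⟨$⟩ʳ_)))
  where
  injective : σ ⟨$⟩ʳ i ≡ σ ⟨$⟩ʳ j → i ≡ j
  injective σi≡σj = trans (sym (inverseˡ σ)) (trans (cong (σ ⟨$⟩ˡ_) σi≡σj) (inverseˡ σ))

==-transpose : ∀ {n} (σ : Permutation′ n) (i j : Fin n) → (i == (σ ⟨$⟩ʳ j)) ≡ ((σ ⟨$⟩ˡ i) == j)
==-transpose σ i j = ==-⇔ (mk⇔ (λ i≡σj → trans (cong (σ ⟨$⟩ˡ_) i≡σj) (inverseˡ σ))
                                (λ σ⁻¹i≡j → trans (sym (inverseʳ σ)) (cong (σ ⟨$⟩ʳ_) σ⁻¹i≡j)))

any-singleton : ∀ {n} (φ : Fin n → Bool) k → any (λ i → φ i ∧ (i == k)) ≡ φ k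
any-singleton {suc n} φ zero = begin
  φ zero ∧ true ∨ any (λ i → φ (suc i) ∧ false)
    ≡⟨ cong₂ _∨_ (∧-identityʳ (φ zero)) (any-cong (λ i → ∧-zeroʳ (φ (suc i)))) ⟩
  φ zero ∨ any {n} (λ _ → false)  ≡⟨ cong (φ zero ∨_) (any-false n) ⟩
  φ zero ∨ false                  ≡⟨ ∨-identityʳ (φ zero) ⟩
  φ zero                          ∎
  where open ≡-Reasoning
any-singleton φ (suc k) = begin
  φ zero ∧ false ∨ any (λ i → φ (suc i) ∧ (suc i == suc k))
    ≡⟨ cong₂ _∨_ (∧-zeroʳ (φ zero)) (any-cong suc-case) ⟩
  any (λ i → φ (suc i) ∧ (i == k))  ≡⟨ any-singleton (φ ∘ suc) k ⟩
  φ (suc k)                         ∎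
  where
  open ≡-Reasoning
  suc-case : ∀ i → φ (suc i) ∧ (suc i == suc k) ≡ φ (suc i) ∧ (i == k)
  suc-case i = cong (φ (suc i) ∧_) (==-⇔ (mk⇔ suc-injective (cong suc)))

any-image : ∀ {n} (φ : Fin n → Bool) (π : Permutation′ n) k →
            any (λ i → φ i ∧ ((π ⟨$⟩ʳ i) == k)) ≡ φ (π ⟨$⟩ˡ k)
any-image φ π k = begin
  any (λ i → φ i ∧ ((π ⟨$⟩ʳ i) == k))                      ≡⟨ any-permute _ (flip π) ⟨
  any (λ i → φ (π ⟨$⟩ˡ i) ∧ ((π ⟨$⟩ʳ (π ⟨$⟩ˡ i)) == k))
    ≡⟨ any-cong (λ i → cong (λ j → φ (π ⟨$⟩ˡ i) ∧ (j == k)) (inverseʳ π)) ⟩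
  any (λ i → φ (π ⟨$⟩ˡ i) ∧ (i == k))                      ≡⟨ any-singleton (φ ∘ (π ⟨$⟩ˡ_)) k ⟩
  φ (π ⟨$⟩ˡ k)                                             ∎
  where open ≡-Reasoning

-- Permutations and fixed points

transpose-matchˡ : ∀ {n} (i j : Fin n) → PC.transpose i j i ≡ j
transpose-matchˡ i j rewrite dec-true (i ≟ i) refl = refl

transpose-fixes : ∀ {n} {i j k : Fin n} → (k ≡ i → j ≡ k) → (k ≡ j → i ≡ k) → PC.transpose i j k ≡ k
transpose-fixes {i = i} {j} {k} k≡i⇒ k≡j⇒ with k ≟ i
... | yes k≡i = k≡i⇒ k≡i
... | no _ with k ≟ j
...   | yes k≡j = k≡j⇒ k≡j
...   | no _    = refl

count-≡⇒rearrange : ∀ {n} (φ ψ : Fin n → Bool) → count φ ≡ count ψ →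
                    ∃ λ (α : Permutation′ n) → ∀ i → ψ (α ⟨$⟩ʳ i) ≡ φ i
count-≡⇒rearrange {zero}  φ ψ _   = id , λ ()
count-≡⇒rearrange {suc n} φ ψ φ≡ψ with count-≡⇒∃value φ ψ φ≡ψ zero
... | k , ψk≡φ0 = lift₀ (proj₁ rest) ∘ₚ τ , rearranged
  where
  τ : Permutation′ (suc n)
  τ = transpose zero k
  head : ψ (τ ⟨$⟩ʳ zero) ≡ φ zero
  head = trans (cong ψ (transpose-matchˡ zero k)) ψk≡φ0
  rest : ∃ λ (β : Permutation′ n) → ∀ i → ψ (τ ⟨$⟩ʳ suc (β ⟨$⟩ʳ i)) ≡ φ (suc i)
  rest = count-≡⇒rearrange (φ ∘ suc) (ψ ∘ (τ ⟨$⟩ʳ_) ∘ suc)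
           (count-tail φ (ψ ∘ (τ ⟨$⟩ʳ_)) (trans φ≡ψ (sym (count-permute ψ τ))) (sym head))
  rearranged : ∀ i → ψ ((lift₀ (proj₁ rest) ∘ₚ τ) ⟨$⟩ʳ i) ≡ φ i
  rearranged zero    = head
  rearranged (suc i) = proj₂ rest i

fixes : ∀ {n} → Permutation′ n → Fin n → Bool
fixes π i = (π ⟨$⟩ʳ i) == i

length-filter-tabulate : ∀ {A : Set} {P : Pred A 0ℓ} (P? : Decidable P) {n} (γ : Fin n → A) →
                         length (filter P? (List.tabulate γ)) ≡ count (λ i → ⌊ P? (γ i) ⌋)
length-filter-tabulate P? {zero}  γ = refl
length-filter-tabulate P? {suc n} γ with P? (γ zero)
... | yes _ = cong suc (length-filter-tabulate P? (γ ∘ suc))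
... | no _  = length-filter-tabulate P? (γ ∘ suc)

fixedPoints≡count : ∀ {n} (π : Permutation′ n) → fixedPoints π ≡ count (fixes π)
fixedPoints≡count π = length-filter-tabulate (λ i → π ⟨$⟩ʳ i ≟ i) (λ i → i)

fixes⇒fixed : ∀ {n} (π : Permutation′ n) {j} → fixes π j ≡ true → π ⟨$⟩ˡ j ≡ j
fixes⇒fixed π fixed = trans (cong (π ⟨$⟩ˡ_) (sym (==⇒≡ fixed))) (inverseˡ π)

fixed⇒fixes : ∀ {n} (π : Permutation′ n) {j} → π ⟨$⟩ˡ j ≡ j → fixes π j ≡ true
fixed⇒fixes π {j} fixed = trans (cong (_== j) (trans (cong (π ⟨$⟩ʳ_) (sym fixed)) (inverseʳ π))) (==-refl j)

-- σ⁻¹ π σ, since _∘ₚ_ composes left to right.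
conj : ∀ {n} → Permutation′ n → Permutation′ n → Permutation′ n
conj σ π = σ ∘ₚ π ∘ₚ flip σ

fixes-conj : ∀ {n} (σ π : Permutation′ n) i → fixes (conj σ π) i ≡ fixes π (σ ⟨$⟩ʳ i)
fixes-conj σ π i = sym (==-transpose σ (π ⟨$⟩ʳ (σ ⟨$⟩ʳ i)) i)

∣tabulate∣ : ∀ {n} (φ : Fin n → Bool) → ∣ tabulate φ ∣ ≡ count φ
∣tabulate∣ {zero}  φ = refl
∣tabulate∣ {suc n} φ with φ zero
... | true  = cong suc (∣tabulate∣ (φ ∘ suc))
... | false = ∣tabulate∣ (φ ∘ suc)

∣_∣≡count : ∀ {n} (I : Subset n) → ∣ I ∣ ≡ count (lookup I)
∣ I ∣≡count = trans (cong ∣_∣ (sym (tabulate∘lookup I))) (∣tabulate∣ (lookup I))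

tabulate-≗lookup : ∀ {A : Set} {m} {φ : Fin m → A} (xs : Vec A m) → φ ≗ lookup xs → tabulate φ ≡ xs
tabulate-≗lookup xs φ≗xs = trans (tabulate-cong φ≗xs) (tabulate∘lookup xs)

∈-tabulate⁺ : ∀ {m} (φ : Fin m → Bool) {u} → φ u ≡ true → u ∈ tabulate φ
∈-tabulate⁺ φ {u} φu = lookup⇒[]= u (tabulate φ) (trans (lookup∘tabulate φ u) φu)

∈-tabulate⁻ : ∀ {m} (φ : Fin m → Bool) {u} → u ∈ tabulate φ → φ u ≡ true
∈-tabulate⁻ φ {u} u∈ = trans (sym (lookup∘tabulate φ u)) ([]=⇒lookup u∈)

∉-tabulate⁺ : ∀ {m} (φ : Fin m → Bool) {u} → φ u ≡ false → u ∉ tabulate φ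
∉-tabulate⁺ φ φu u∈ with trans (sym (∈-tabulate⁻ φ u∈)) φu
... | ()

anyᴸ-tabulate : ∀ {A : Set} (p : A → Bool) {n} (γ : Fin n → A) → anyᴸ p (List.tabulate γ) ≡ any (p ∘ γ)
anyᴸ-tabulate p {zero}  γ = refl
anyᴸ-tabulate p {suc n} γ = cong (p (γ zero) ∨_) (anyᴸ-tabulate p (γ ∘ suc))

∣N∣≡count : ∀ {m} (G : Graph m) (S : Subset m) → ∣ N G S ∣ ≡ count (λ v → any (λ u → lookup S u ∧ G u v))
∣N∣≡count {m} G S =
  trans (∣tabulate∣ (λ v → anyᴸ (λ u → lookup S u ∧ G u v) (allFin m)))
        (count-cong (λ v → anyᴸ-tabulate (λ u → lookup S u ∧ G u v) (λ u → u)))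

lookup-⁅⁆ : ∀ {n} (j k : Fin n) → lookup ⁅ j ⁆ k ≡ (j == k)
lookup-⁅⁆ zero    zero    = refl
lookup-⁅⁆ zero    (suc k) = lookup-replicate k false
lookup-⁅⁆ (suc j) zero    = refl
lookup-⁅⁆ (suc j) (suc k) = trans (lookup-⁅⁆ j k) (==-⇔ (mk⇔ (cong suc) suc-injective))

⁅⁆-injective : ∀ {n} {i j : Fin n} → ⁅ i ⁆ ≡ ⁅ j ⁆ → i ≡ j
⁅⁆-injective {i = i} {j} ⁅i⁆≡⁅j⁆ = x∈⁅y⁆⇒x≡y j (subst (i ∈_) ⁅i⁆≡⁅j⁆ (x∈⁅x⁆ i))

singleton? : ∀ {n} (J : Subset n) → Dec (∃ λ j → J ≡ ⁅ j ⁆)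
singleton? J = any? (λ j → ≡-dec _≟ᵇ_ J ⁅ j ⁆)

any-false⇒⊆⁅⁆ : ∀ {n} {J : Subset n} k → any (λ j → lookup J j ∧ not (j == k)) ≡ false → J ⊆ ⁅ k ⁆
any-false⇒⊆⁅⁆ {J = J} k none {j} j∈J with j ≟ k
... | yes j≡k = subst (_∈ ⁅ k ⁆) (sym j≡k) (x∈⁅x⁆ k)
... | no  j≢k = contradiction (trans (sym (true⇒any _ j witness)) none) λ ()
  where
  witness : lookup J j ∧ not (j == k) ≡ true
  witness = cong₂ _∧_ ([]=⇒lookup j∈J) (cong not (≢⇒==false j≢k))

⊆⁅⁆⇒≡⁅⁆ : ∀ {n} {J : Subset n} {j k} → j ∈ J → J ⊆ ⁅ k ⁆ → J ≡ ⁅ k ⁆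
⊆⁅⁆⇒≡⁅⁆ {J = J} {j} {k} j∈J J⊆⁅k⁆ = ⊆-antisym J⊆⁅k⁆ ⁅k⁆⊆J
  where
  ⁅k⁆⊆J : ⁅ k ⁆ ⊆ J
  ⁅k⁆⊆J {i} i∈⁅k⁆ = subst (_∈ J) (trans (x∈⁅y⁆⇒x≡y k (J⊆⁅k⁆ j∈J)) (sym (x∈⁅y⁆⇒x≡y k i∈⁅k⁆))) j∈J

covered-or-singleton : ∀ {n} {J : Subset n} {j} → j ∈ J → ∀ k →
                       any (λ i → lookup J i ∧ not (i == k)) ≡ true ⊎ J ≡ ⁅ k ⁆
covered-or-singleton {J = J} j∈J k with any (λ i → lookup J i ∧ not (i == k)) in covered
... | true  = inj₁ refl
... | false = inj₂ (⊆⁅⁆⇒≡⁅⁆ j∈J (any-false⇒⊆⁅⁆ k covered))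

_⊙_ : ∀ {n} → Permutation′ n → Subset n → Subset n
σ ⊙ I = tabulate (λ i → lookup I (σ ⟨$⟩ˡ i))

lookup-⊙ : ∀ {n} (σ : Permutation′ n) I i → lookup (σ ⊙ I) (σ ⟨$⟩ʳ i) ≡ lookup I i
lookup-⊙ σ I i = trans (lookup∘tabulate _ (σ ⟨$⟩ʳ i)) (cong (lookup I) (inverseˡ σ))

flip-⊙ : ∀ {n} (σ : Permutation′ n) I → flip σ ⊙ (σ ⊙ I) ≡ I
flip-⊙ σ I = tabulate-≗lookup I (lookup-⊙ σ I)

∣⊙∣ : ∀ {n} (σ : Permutation′ n) I → ∣ σ ⊙ I ∣ ≡ ∣ I ∣
∣⊙∣ σ I = trans (∣tabulate∣ (λ i → lookup I (σ ⟨$⟩ˡ i)))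
                (trans (count-permute (lookup I) (flip σ)) (sym ∣ I ∣≡count))

⊙-⁅⁆ : ∀ {n} (σ : Permutation′ n) j → σ ⊙ ⁅ j ⁆ ≡ ⁅ σ ⟨$⟩ʳ j ⁆
⊙-⁅⁆ σ j = tabulate-≗lookup ⁅ σ ⟨$⟩ʳ j ⁆ (λ k → begin
  lookup ⁅ j ⁆ (σ ⟨$⟩ˡ k)  ≡⟨ lookup-⁅⁆ j (σ ⟨$⟩ˡ k) ⟩
  (j == (σ ⟨$⟩ˡ k))        ≡⟨ ==-transpose (flip σ) j k ⟩
  ((σ ⟨$⟩ʳ j) == k)        ≡⟨ lookup-⁅⁆ (σ ⟨$⟩ʳ j) k ⟨
  lookup ⁅ σ ⟨$⟩ʳ j ⁆ k    ∎)
  where open ≡-Reasoning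

-- The graph G_π

efg : ∀ {n} → Fin 3 → Vtx n
efg zero             = e
efg (suc zero)       = f
efg (suc (suc zero)) = g

module _ {n : ℕ} where

  encode : Vtx n → Fin (nV n)
  encode (a i) = i ↑ˡ (n + (n + (n + 3)))
  encode (b i) = n ↑ʳ (i ↑ˡ (n + (n + 3)))
  encode (c i) = n ↑ʳ (n ↑ʳ (i ↑ˡ (n + 3)))
  encode (d i) = n ↑ʳ (n ↑ʳ (n ↑ʳ (i ↑ˡ 3)))
  encode e     = n ↑ʳ (n ↑ʳ (n ↑ʳ (n ↑ʳ zero)))
  encode f     = n ↑ʳ (n ↑ʳ (n ↑ʳ (n ↑ʳ suc zero)))
  encode g     = n ↑ʳ (n ↑ʳ (n ↑ʳ (n ↑ʳ suc (suc zero))))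

  decode-efg : ∀ x → decode n (n ↑ʳ (n ↑ʳ (n ↑ʳ (n ↑ʳ x)))) ≡ efg x
  decode-efg x
    rewrite splitAt-↑ʳ n (n + (n + (n + 3))) (n ↑ʳ (n ↑ʳ (n ↑ʳ x)))
          | splitAt-↑ʳ n (n + (n + 3)) (n ↑ʳ (n ↑ʳ x))
          | splitAt-↑ʳ n (n + 3) (n ↑ʳ x)
          | splitAt-↑ʳ n 3 x
    with x
  ... | zero           = refl
  ... | suc zero       = refl
  ... | suc (suc zero) = refl

  decode-encode : ∀ x → decode n (encode x) ≡ x
  decode-encode (a i)
    rewrite splitAt-↑ˡ n i (n + (n + (n + 3))) = refl
  decode-encode (b i)
    rewrite splitAt-↑ʳ n (n + (n + (n + 3))) (i ↑ˡ (n + (n + 3)))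
          | splitAt-↑ˡ n i (n + (n + 3)) = refl
  decode-encode (c i)
    rewrite splitAt-↑ʳ n (n + (n + (n + 3))) (n ↑ʳ (i ↑ˡ (n + 3)))
          | splitAt-↑ʳ n (n + (n + 3)) (i ↑ˡ (n + 3))
          | splitAt-↑ˡ n i (n + 3) = refl
  decode-encode (d i)
    rewrite splitAt-↑ʳ n (n + (n + (n + 3))) (n ↑ʳ (n ↑ʳ (i ↑ˡ 3)))
          | splitAt-↑ʳ n (n + (n + 3)) (n ↑ʳ (i ↑ˡ 3))
          | splitAt-↑ʳ n (n + 3) (i ↑ˡ 3)
          | splitAt-↑ˡ n i 3 = refl
  decode-encode e = decode-efg zero
  decode-encode f = decode-efg (suc zero)
  decode-encode g = decode-efg (suc (suc zero))

  private
    peel : ∀ {k} {v : Fin (n + k)} {w w′} → splitAt n v ≡ inj₂ w → w′ ≡ w → n ↑ʳ w′ ≡ v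
    peel split refl = splitAt⁻¹-↑ʳ split

  encode-decode : ∀ u → encode (decode n u) ≡ u
  encode-decode u with splitAt n u in p₀
  ... | inj₁ _  = splitAt⁻¹-↑ˡ p₀
  ... | inj₂ u₁ with splitAt n u₁ in p₁
  ...   | inj₁ _  = peel p₀ (splitAt⁻¹-↑ˡ p₁)
  ...   | inj₂ u₂ with splitAt n u₂ in p₂
  ...     | inj₁ _  = peel p₀ (peel p₁ (splitAt⁻¹-↑ˡ p₂))
  ...     | inj₂ u₃ with splitAt n u₃ in p₃
  ...       | inj₁ _                = peel p₀ (peel p₁ (peel p₂ (splitAt⁻¹-↑ˡ p₃)))
  ...       | inj₂ zero             = peel p₀ (peel p₁ (peel p₂ (peel p₃ refl)))
  ...       | inj₂ (suc zero)       = peel p₀ (peel p₁ (peel p₂ (peel p₃ refl)))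
  ...       | inj₂ (suc (suc zero)) = peel p₀ (peel p₁ (peel p₂ (peel p₃ refl)))

module _ {ℓ₁ ℓ₂} (M : Monoid ℓ₁ ℓ₂) where
  open Monoid M using (Carrier; _∙_; ∙-cong; ∙-congˡ; assoc; identityˡ; reflexive)
    renaming (_≈_ to _≃_; sym to ≃-sym; trans to ≃-trans)
  open MonoidSum M using (sum; sum-cong-≗)

  sum-↑ : ∀ m {k} (φ : Fin (m + k) → Carrier) → sum φ ≃ sum (φ ∘ (_↑ˡ k)) ∙ sum (φ ∘ (m ↑ʳ_))
  sum-↑ zero    φ = ≃-sym (identityˡ _)
  sum-↑ (suc m) φ = ≃-trans (∙-congˡ (sum-↑ m (φ ∘ suc))) (≃-sym (assoc _ _ _))

  sum-decode : ∀ {n} (h : Vtx n → Carrier) →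
               sum (h ∘ decode n) ≃ sum (h ∘ a) ∙ (sum (h ∘ b) ∙ (sum (h ∘ c) ∙ (sum (h ∘ d) ∙ sum (h ∘ efg))))
  sum-decode {n} h =
    ≃-trans (sum-↑ n _) (∙-cong (block a) (
    ≃-trans (sum-↑ n _) (∙-cong (block b) (
    ≃-trans (sum-↑ n _) (∙-cong (block c) (
    ≃-trans (sum-↑ n _) (∙-cong (block d) (
    reflexive (sum-cong-≗ (cong h ∘ decode-efg))))))))))
    where
    block : (x : Fin n → Vtx n) → sum (h ∘ decode n ∘ encode ∘ x) ≃ sum (h ∘ x)
    block x = reflexive (sum-cong-≗ (cong h ∘ decode-encode ∘ x))

module _ {n : ℕ} where

  countᵥ : (Vtx n → Bool) → ℕ
  countᵥ h = count (h ∘ a) + (count (h ∘ b) + (count (h ∘ c) + (count (h ∘ d) + count (h ∘ efg))))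

  anyᵥ : (Vtx n → Bool) → Bool
  anyᵥ h = any (h ∘ a) ∨ (any (h ∘ b) ∨ (any (h ∘ c) ∨ (any (h ∘ d) ∨ any (h ∘ efg))))

  count-decode : ∀ h → count (h ∘ decode n) ≡ countᵥ h
  count-decode h = sum-decode (CommutativeMonoid.monoid +-0-commutativeMonoid) (fromBool ∘ h)

  any-decode : ∀ h → any (h ∘ decode n) ≡ anyᵥ h
  any-decode = sum-decode (CommutativeMonoid.monoid ∨-commutativeMonoid)

  countᵥ-cong : ∀ {h k} → h ≗ k → countᵥ h ≡ countᵥ k
  countᵥ-cong {h} {k} h≗k =
    trans (sym (count-decode h)) (trans (count-cong (h≗k ∘ decode n)) (count-decode k))

  inX : Vtx n → Bool
  inX (a _) = true
  inX (b _) = false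
  inX (c _) = true
  inX (d _) = false
  inX e     = true
  inX f     = false
  inX g     = false

X : ∀ n → Subset (nV n)
X n = tabulate (inX ∘ decode n)

∣X∣≤∣∁X∣ : ∀ n → ∣ X n ∣ ≤ ∣ ∁ (X n) ∣
∣X∣≤∣∁X∣ n = begin
  ∣ X n ∣                       ≡⟨ ∣tabulate∣ (inX ∘ decode n) ⟩
  count (inX ∘ decode n)        ≡⟨ count-decode {n} inX ⟩
  countᵥ {n} inX                ≡⟨ cong₂ (λ x y → x + (y + (x + (y + 1)))) (count-true n) (count-false n) ⟩
  n + (n + 1)                   ≤⟨ +-monoʳ-≤ n (+-monoʳ-≤ n (n≤1+n 1)) ⟩
  n + (n + 2)                   ≡⟨ cong₂ (λ x y → x + (y + (x + (y + 2)))) (count-false n) (count-true n) ⟨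
  countᵥ {n} (not ∘ inX)        ≡⟨ count-decode {n} (not ∘ inX) ⟨
  count (not ∘ inX ∘ decode n)  ≡⟨ count-cong (λ u → sym (trans (lookup-map u not (X n))
                                                                (cong not (lookup∘tabulate (inX ∘ decode n) u)))) ⟩
  count (lookup (∁ (X n)))      ≡⟨ ∣ ∁ (X n) ∣≡count ⟨
  ∣ ∁ (X n) ∣                   ∎
  where open ≤-Reasoning

module _ {n : ℕ} (π : Permutation′ n) where

  adjacent-sides : ∀ x y → adjV π x y ≡ true → inX x ≡ not (inX y)
  adjacent-sides (a _) = λ { (a _) () ; (b _) _ → refl ; (c _) () ; (d _) _ → refl ; e () ; f _ → refl ; g _ → refl }
  adjacent-sides (b _) = λ { (a _) _ → refl ; (b _) () ; (c _) _ → refl ; (d _) () ; e _ → refl ; f () ; g () }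
  adjacent-sides (c _) = λ { (a _) () ; (b _) _ → refl ; (c _) () ; (d _) _ → refl ; e () ; f _ → refl ; g _ → refl }
  adjacent-sides (d _) = λ { (a _) _ → refl ; (b _) () ; (c _) _ → refl ; (d _) () ; e _ → refl ; f () ; g () }
  adjacent-sides e     = λ { (a _) () ; (b _) _ → refl ; (c _) () ; (d _) _ → refl ; e () ; f _ → refl ; g _ → refl }
  adjacent-sides f     = λ { (a _) _ → refl ; (b _) () ; (c _) _ → refl ; (d _) () ; e _ → refl ; f () ; g () }
  adjacent-sides g     = λ { (a _) _ → refl ; (b _) () ; (c _) _ → refl ; (d _) () ; e _ → refl ; f () ; g () }

  bipartite : IsBipartition (Gπ π) (X n)
  bipartite u v uv with inX (decode n v) in side
  ... | true  = inj₂ (∉-tabulate⁺ _ (trans (adjacent-sides _ _ uv) (cong not side)) , ∈-tabulate⁺ _ side)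
  ... | false = inj₁ (∈-tabulate⁺ _ (trans (adjacent-sides _ _ uv) (cong not side)) , ∉-tabulate⁺ _ side)

  edge : ∀ x y → adjV π x y ≡ true → Adj (Gπ π) (encode x) (encode y)
  edge x y = subst₂ (λ x′ y′ → adjV π x′ y′ ≡ true) (sym (decode-encode x)) (sym (decode-encode y))

  walk-to-f : ∀ x → Star (Adj (Gπ π)) (encode x) (encode {n} f)
  walk-to-f (a i) = edge (a i) f refl ◅ ε
  walk-to-f (b i) = edge (b i) e refl ◅ edge e f refl ◅ ε
  walk-to-f (c i) = edge (c i) f refl ◅ ε
  walk-to-f (d i) = edge (d i) e refl ◅ edge e f refl ◅ ε
  walk-to-f e     = edge e f refl ◅ ε
  walk-to-f f     = ε
  walk-to-f g     = edge g e refl ◅ edge e f refl ◅ ε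

  walk-from-f : ∀ x → Star (Adj (Gπ π)) (encode {n} f) (encode x)
  walk-from-f (a i) = edge f (a i) refl ◅ ε
  walk-from-f (b i) = edge f e refl ◅ edge e (b i) refl ◅ ε
  walk-from-f (c i) = edge f (c i) refl ◅ ε
  walk-from-f (d i) = edge f e refl ◅ edge e (d i) refl ◅ ε
  walk-from-f e     = edge f e refl ◅ ε
  walk-from-f f     = ε
  walk-from-f g     = edge f e refl ◅ edge e g refl ◅ ε

  connected : Connected (Gπ π)
  connected u v = subst₂ (Star (Adj (Gπ π))) (encode-decode {n} u) (encode-decode {n} v)
                         (walk-to-f (decode n u) ◅◅ walk-from-f (decode n v))

-- Subsets of X

XSubset : ℕ → Set
XSubset n = Subset n × Subset n × Bool

module _ {n : ℕ} where

  member : XSubset n → Vtx n → Bool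
  member (I , J , e?) (a i) = lookup I i
  member (I , J , e?) (b _) = false
  member (I , J , e?) (c j) = lookup J j
  member (I , J , e?) (d _) = false
  member (I , J , e?) e     = e?
  member (I , J , e?) f     = false
  member (I , J , e?) g     = false

  vertices : XSubset n → Subset (nV n)
  vertices t = tabulate (member t ∘ decode n)

  parts : Subset (nV n) → XSubset n
  parts S = tabulate (lookup S ∘ encode ∘ a) , tabulate (lookup S ∘ encode ∘ c) , lookup S (encode {n} e)

  member⇒inX : ∀ t x → member t x ≡ true → inX x ≡ true
  member⇒inX t (a _) _ = refl
  member⇒inX t (c _) _ = refl
  member⇒inX t e     _ = refl

  vertices⊆X : ∀ t → vertices t ⊆ X n
  vertices⊆X t {u} u∈ = ∈-tabulate⁺ _ (member⇒inX t (decode n u) (∈-tabulate⁻ _ u∈))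

  lookup-vertices : ∀ t x → lookup (vertices t) (encode x) ≡ member t x
  lookup-vertices t x = trans (lookup∘tabulate _ (encode x)) (cong (member t) (decode-encode x))

  parts-vertices : ∀ t → parts (vertices t) ≡ t
  parts-vertices t@(I , J , e?) =
    cong₂ _,_ (tabulate-≗lookup I (lookup-vertices t ∘ a))
              (cong₂ _,_ (tabulate-≗lookup J (lookup-vertices t ∘ c)) (lookup-vertices t e))

  outside-X : ∀ {S} → S ⊆ X n → ∀ (x : Vtx n) → inX x ≡ false → lookup S (encode x) ≡ false
  outside-X {S} S⊆X x x∉X with lookup S (encode x) in x∈S
  ... | false = refl
  ... | true  = contradiction (S⊆X (lookup⇒[]= _ S x∈S))
                              (∉-tabulate⁺ _ (trans (cong inX (decode-encode x)) x∉X))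

  member-parts : ∀ {S} → S ⊆ X n → ∀ (x : Vtx n) → member (parts S) x ≡ lookup S (encode x)
  member-parts S⊆X (a i) = lookup∘tabulate _ i
  member-parts S⊆X (b i) = sym (outside-X S⊆X (b i) refl)
  member-parts S⊆X (c j) = lookup∘tabulate _ j
  member-parts S⊆X (d i) = sym (outside-X S⊆X (d i) refl)
  member-parts S⊆X e     = refl
  member-parts S⊆X f     = sym (outside-X S⊆X f refl)
  member-parts S⊆X g     = sym (outside-X S⊆X g refl)

  vertices-parts : ∀ S → S ⊆ X n → vertices (parts S) ≡ S
  vertices-parts S S⊆X =
    tabulate-≗lookup S (λ u → trans (member-parts S⊆X (decode n u)) (cong (lookup S) (encode-decode {n} u)))

  size : XSubset n → ℕ
  size (I , J , e?) = ∣ I ∣ + (∣ J ∣ + fromBool e?)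

  ∣vertices∣ : ∀ t → ∣ vertices t ∣ ≡ size t
  ∣vertices∣ t@(I , J , e?) = begin
    ∣ vertices t ∣               ≡⟨ ∣tabulate∣ (member t ∘ decode n) ⟩
    count (member t ∘ decode n)  ≡⟨ count-decode (member t) ⟩
    countᵥ (member t)
      ≡⟨ cong₂ (λ x y → count (lookup I) + (x + (count (lookup J) + (x + y))))
               (count-false n) (+-identityʳ (fromBool e?)) ⟩
    count (lookup I) + (count (lookup J) + fromBool e?)
      ≡⟨ cong₂ (λ x y → x + (y + fromBool e?)) ∣ I ∣≡count ∣ J ∣≡count ⟨
    size t                       ∎
    where open ≡-Reasoning

  neighbours : Permutation′ n → XSubset n → Vtx n → Bool
  neighbours π (I , J , e?) y =
    any (λ i → lookup I i ∧ adjV π (a i) y) ∨ (any (λ j → lookup J j ∧ adjV π (c j) y) ∨ (e? ∧ adjV π e y))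

  nsize : Permutation′ n → XSubset n → ℕ
  nsize π t = countᵥ (neighbours π t)

  anyᵥ-member : ∀ I J e? (h : Vtx n → Bool) →
    anyᵥ (λ x → member (I , J , e?) x ∧ h x) ≡
    any (λ i → lookup I i ∧ h (a i)) ∨ (any (λ j → lookup J j ∧ h (c j)) ∨ (e? ∧ h e))
  anyᵥ-member I J e? h =
    cong₂ (λ x y → any (λ i → lookup I i ∧ h (a i)) ∨ (x ∨ (any (λ j → lookup J j ∧ h (c j)) ∨ (x ∨ y))))
          (any-false n) (∨-identityʳ (e? ∧ h e))

  ∣N∣≡nsize : ∀ π t → ∣ N (Gπ π) (vertices t) ∣ ≡ nsize π t
  ∣N∣≡nsize π t@(I , J , e?) = begin
    ∣ N (Gπ π) (vertices t) ∣                                  ≡⟨ ∣N∣≡count (Gπ π) (vertices t) ⟩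
    count (λ v → any (λ u → lookup (vertices t) u ∧ Gπ π u v))
      ≡⟨ count-cong (λ v → any-cong (λ u → cong (_∧ Gπ π u v) (lookup∘tabulate (member t ∘ decode n) u))) ⟩
    count (λ v → any (λ u → member t (decode n u) ∧ Gπ π u v))
      ≡⟨ count-cong (λ v → trans (any-decode {n} (λ x → member t x ∧ adjV π x (decode n v)))
                                 (anyᵥ-member I J e? (λ x → adjV π x (decode n v)))) ⟩
    count (neighbours π t ∘ decode n)                          ≡⟨ count-decode (neighbours π t) ⟩
    nsize π t                                                  ∎
    where open ≡-Reasoning

SizePreserving : ∀ {n} → Permutation′ n → Permutation′ n → (XSubset n → XSubset n) → Set
SizePreserving π₁ π₂ φ = ∀ t → size (φ t) ≡ size t × nsize π₂ (φ t) ≡ nsize π₁ t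

∘-preserving : ∀ {n} {π₁ π₂ π₃ : Permutation′ n} {φ ψ} →
               SizePreserving π₁ π₂ φ → SizePreserving π₂ π₃ ψ → SizePreserving π₁ π₃ (ψ ∘ φ)
∘-preserving φ-preserving ψ-preserving t =
  trans (proj₁ (ψ-preserving _)) (proj₁ (φ-preserving t)) ,
  trans (proj₂ (ψ-preserving _)) (proj₂ (φ-preserving t))

-- Relabelling by a permutation

_⊙ˣ_ : ∀ {n} → Permutation′ n → XSubset n → XSubset n
σ ⊙ˣ (I , J , e?) = σ ⊙ I , σ ⊙ J , e?

⊙ˣ-↔ : ∀ {n} → Permutation′ n → XSubset n ↔ XSubset n
⊙ˣ-↔ σ = mk↔ₛ′ (σ ⊙ˣ_) (flip σ ⊙ˣ_)
  (λ (I , J , e?) → cong₂ _,_ (flip-⊙ (flip σ) I) (cong (_, e?) (flip-⊙ (flip σ) J)))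
  (λ (I , J , e?) → cong₂ _,_ (flip-⊙ σ I) (cong (_, e?) (flip-⊙ σ J)))

module _ {n : ℕ} (σ : Permutation′ n) where

  rename : Vtx n → Vtx n
  rename (a i) = a (σ ⟨$⟩ʳ i)
  rename (b i) = b (σ ⟨$⟩ʳ i)
  rename (c i) = c (σ ⟨$⟩ʳ i)
  rename (d i) = d (σ ⟨$⟩ʳ i)
  rename e     = e
  rename f     = f
  rename g     = g

  adjV-rename : ∀ π x y → adjV π (rename x) (rename y) ≡ adjV (conj σ π) x y
  adjV-rename π (a i) = λ { (a _) → refl ; (b j) → cong not (==-permute σ i j) ; (c _) → refl
                          ; (d j) → ==-transpose σ (π ⟨$⟩ʳ (σ ⟨$⟩ʳ i)) j ; e → refl ; f → refl ; g → refl }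
  adjV-rename π (b i) = λ { (a j) → cong not (==-permute σ j i) ; (b _) → refl ; (c j) → ==-permute σ i j
                          ; (d _) → refl ; e → refl ; f → refl ; g → refl }
  adjV-rename π (c i) = λ { (a _) → refl ; (b j) → ==-permute σ j i ; (c _) → refl
                          ; (d j) → cong not (==-permute σ i j) ; e → refl ; f → refl ; g → refl }
  adjV-rename π (d i) = λ { (a j) → ==-transpose σ (π ⟨$⟩ʳ (σ ⟨$⟩ʳ j)) i ; (b _) → refl
                          ; (c j) → cong not (==-permute σ j i) ; (d _) → refl ; e → refl ; f → refl ; g → refl }
  adjV-rename π e     = λ { (a _) → refl ; (b _) → refl ; (c _) → refl ; (d _) → refl ; e → refl ; f → refl ; g → refl }
  adjV-rename π f     = λ { (a _) → refl ; (b _) → refl ; (c _) → refl ; (d _) → refl ; e → refl ; f → refl ; g → refl }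
  adjV-rename π g     = λ { (a _) → refl ; (b _) → refl ; (c _) → refl ; (d _) → refl ; e → refl ; f → refl ; g → refl }

  countᵥ-rename : ∀ h → countᵥ (h ∘ rename) ≡ countᵥ h
  countᵥ-rename h =
    cong₂ _+_ (count-permute (h ∘ a) σ) (cong₂ _+_ (count-permute (h ∘ b) σ)
      (cong₂ _+_ (count-permute (h ∘ c) σ) (cong₂ _+_ (count-permute (h ∘ d) σ) refl)))

  any-⊙ : ∀ I {φ ψ : Fin n → Bool} → (∀ i → ψ (σ ⟨$⟩ʳ i) ≡ φ i) →
          any (λ i → lookup (σ ⊙ I) i ∧ ψ i) ≡ any (λ i → lookup I i ∧ φ i)
  any-⊙ I ψσ≗φ = trans (sym (any-permute _ σ)) (any-cong (λ i → cong₂ _∧_ (lookup-⊙ σ I i) (ψσ≗φ i)))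

  neighbours-rename : ∀ π t y → neighbours π (σ ⊙ˣ t) (rename y) ≡ neighbours (conj σ π) t y
  neighbours-rename π (I , J , e?) y =
    cong₂ _∨_ (any-⊙ I (λ i → adjV-rename π (a i) y))
              (cong₂ _∨_ (any-⊙ J (λ j → adjV-rename π (c j) y)) (cong (e? ∧_) (adjV-rename π e y)))

  ⊙ˣ-preserving : ∀ π → SizePreserving (conj σ π) π (σ ⊙ˣ_)
  ⊙ˣ-preserving π (I , J , e?) =
    cong₂ (λ x y → x + (y + fromBool e?)) (∣⊙∣ σ I) (∣⊙∣ σ J) ,
    trans (sym (countᵥ-rename (neighbours π (σ ⊙ˣ (I , J , e?)))))
          (countᵥ-cong (neighbours-rename π (I , J , e?)))

-- Matching the neighbourhood sizes

module _ {n : ℕ} (ρ π : Permutation′ n) (I J : Subset n) (e? : Bool) where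

  private
    rest : Fin n → Bool
    rest k = any (λ j → lookup J j ∧ not (j == k)) ∨ (e? ∧ true)

    d-block : ∀ σ → count (λ k → neighbours σ (I , J , e?) (d k)) ≡
                    count (λ k → lookup I (σ ⟨$⟩ˡ k) ∨ rest k)
    d-block σ = count-cong (λ k → cong (_∨ rest k) (any-image (lookup I) σ k))

  -- The other blocks of the neighbourhood do not mention the permutation at all.
  nsize-indep : (∀ j → J ≡ ⁅ j ⁆ → ρ ⟨$⟩ˡ j ≡ π ⟨$⟩ˡ j) → nsize ρ (I , J , e?) ≡ nsize π (I , J , e?)
  nsize-indep agree =
    cong (λ x → count (Nρ ∘ a) + (count (Nρ ∘ b) + (count (Nρ ∘ c) + (x + count (Nρ ∘ efg))))) d-blocks
    where
    Nρ : Vtx n → Bool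
    Nρ = neighbours ρ (I , J , e?)
    d-blocks : count (λ k → Nρ (d k)) ≡ count (λ k → neighbours π (I , J , e?) (d k))
    d-blocks with nonempty? J
    ... | yes (j , j∈J) = trans (d-block ρ) (trans (count-cong cell) (sym (d-block π)))
      where
      cell : ∀ k → lookup I (ρ ⟨$⟩ˡ k) ∨ rest k ≡ lookup I (π ⟨$⟩ˡ k) ∨ rest k
      cell k with covered-or-singleton j∈J k
      ... | inj₁ covered = trans (∨-true (lookup I (ρ ⟨$⟩ˡ k)) (cong (_∨ (e? ∧ true)) covered))
                                 (sym (∨-true (lookup I (π ⟨$⟩ˡ k)) (cong (_∨ (e? ∧ true)) covered)))
      ... | inj₂ J≡⁅k⁆   = cong (λ i → lookup I i ∨ rest k) (agree k J≡⁅k⁆)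
    ... | no J-empty = trans (d-block ρ) (trans (permuted ρ) (sym (trans (d-block π) (permuted π))))
      where
      rest-empty : ∀ k → rest k ≡ e? ∧ true
      rest-empty k = cong (_∨ (e? ∧ true)) (trans
        (any-cong (λ j → cong (_∧ not (j == k)) (¬-not (J-empty ∘ (j ,_) ∘ lookup⇒[]= j J))))
        (any-false n))
      permuted : ∀ σ → count (λ k → lookup I (σ ⟨$⟩ˡ k) ∨ rest k) ≡ count (λ k → lookup I k ∨ (e? ∧ true))
      permuted σ = trans (count-cong (λ k → cong (lookup I (σ ⟨$⟩ˡ k) ∨_) (rest-empty k)))
                         (count-permute (λ k → lookup I k ∨ (e? ∧ true)) (flip σ))

module _ {n : ℕ} (π₁ π₃ : Permutation′ n) (same-fixes : ∀ j → fixes π₁ j ≡ fixes π₃ j) where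

  swapper : Subset n → Permutation′ n
  swapper J with singleton? J
  ... | yes (j , _) = transpose (π₁ ⟨$⟩ˡ j) (π₃ ⟨$⟩ˡ j)
  ... | no _        = id

  swapper-fixes : ∀ j → PC.transpose (π₁ ⟨$⟩ˡ j) (π₃ ⟨$⟩ˡ j) j ≡ j
  swapper-fixes j = transpose-fixes
    (λ j≡π₁⁻¹j → fixes⇒fixed π₃ (trans (sym (same-fixes j)) (fixed⇒fixes π₁ (sym j≡π₁⁻¹j))))
    (λ j≡π₃⁻¹j → fixes⇒fixed π₁ (trans (same-fixes j) (fixed⇒fixes π₃ (sym j≡π₃⁻¹j))))

  swapper-⊙ : ∀ J → swapper J ⊙ J ≡ J
  swapper-⊙ J with singleton? J
  ... | no _            = tabulate∘lookup J
  ... | yes (j , J≡⁅j⁆) = begin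
    θ ⊙ J         ≡⟨ cong (θ ⊙_) J≡⁅j⁆ ⟩
    θ ⊙ ⁅ j ⁆     ≡⟨ ⊙-⁅⁆ θ j ⟩
    ⁅ θ ⟨$⟩ʳ j ⁆  ≡⟨ cong ⁅_⁆ (swapper-fixes j) ⟩
    ⁅ j ⁆         ≡⟨ J≡⁅j⁆ ⟨
    J             ∎
    where
    open ≡-Reasoning
    θ : Permutation′ n
    θ = transpose (π₁ ⟨$⟩ˡ j) (π₃ ⟨$⟩ˡ j)

  swapper-conj : ∀ J j → J ≡ ⁅ j ⁆ → conj (swapper J) π₃ ⟨$⟩ˡ j ≡ π₁ ⟨$⟩ˡ j
  swapper-conj J j J≡⁅j⁆ with singleton? J
  ... | no not-singleton  = contradiction (j , J≡⁅j⁆) not-singleton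
  ... | yes (j′ , J≡⁅j′⁆) with ⁅⁆-injective (trans (sym J≡⁅j⁆) J≡⁅j′⁆)
  ...   | refl = trans (cong (λ k → PC.transpose (π₃ ⟨$⟩ˡ j) (π₁ ⟨$⟩ˡ j) (π₃ ⟨$⟩ˡ k)) (swapper-fixes j))
                       (transpose-matchˡ (π₃ ⟨$⟩ˡ j) (π₁ ⟨$⟩ˡ j))

  swap : XSubset n → XSubset n
  swap (I , J , e?) = swapper J ⊙ I , J , e?

  swap-↔ : XSubset n ↔ XSubset n
  swap-↔ = mk↔ₛ′ swap (λ (I , J , e?) → flip (swapper J) ⊙ I , J , e?)
                 (λ (I , J , e?) → cong (_, J , e?) (flip-⊙ (flip (swapper J)) I))
                 (λ (I , J , e?) → cong (_, J , e?) (flip-⊙ (swapper J) I))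

  swap-preserving : SizePreserving π₁ π₃ swap
  swap-preserving (I , J , e?) = cong (_+ (∣ J ∣ + fromBool e?)) (∣⊙∣ θ I) , (begin
    nsize π₃ (θ ⊙ I , J , e?)       ≡⟨ cong (λ J′ → nsize π₃ (θ ⊙ I , J′ , e?)) (swapper-⊙ J) ⟨
    nsize π₃ (θ ⊙ˣ (I , J , e?))    ≡⟨ proj₂ (⊙ˣ-preserving θ π₃ (I , J , e?)) ⟩
    nsize (conj θ π₃) (I , J , e?)  ≡⟨ nsize-indep (conj θ π₃) π₁ I J e? (swapper-conj J) ⟩
    nsize π₁ (I , J , e?)           ∎)
    where
    open ≡-Reasoning
    θ : Permutation′ n
    θ = swapper J

xsubset-bijection : ∀ {n} (π₁ π₂ : Permutation′ n) → fixedPoints π₁ ≡ fixedPoints π₂ →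
                    ∃ λ (φ : XSubset n ↔ XSubset n) → SizePreserving π₁ π₂ (Inverse.to φ)
xsubset-bijection π₁ π₂ same-count =
  uncurry aligned (count-≡⇒rearrange (fixes π₁) (fixes π₂)
                    (trans (sym (fixedPoints≡count π₁)) (trans same-count (fixedPoints≡count π₂))))
  where
  aligned : ∀ α → (∀ i → fixes π₂ (α ⟨$⟩ʳ i) ≡ fixes π₁ i) →
            ∃ λ (φ : XSubset _ ↔ XSubset _) → SizePreserving π₁ π₂ (Inverse.to φ)
  aligned α α-aligned =
    ⊙ˣ-↔ α ↔-∘ swap-↔ π₁ (conj α π₂) same-fixes ,
    ∘-preserving {π₁ = π₁} {conj α π₂} {π₂} {swap π₁ (conj α π₂) same-fixes} {α ⊙ˣ_}
                 (swap-preserving π₁ (conj α π₂) same-fixes) (⊙ˣ-preserving α π₂)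
    where
    same-fixes : ∀ j → fixes π₁ j ≡ fixes (conj α π₂) j
    same-fixes j = sym (trans (fixes-conj α π₂ j) (α-aligned j))

-- Transport to subsets of the vertex set

NeighbourhoodSizeBijection : ∀ {m m′} → Graph m → Graph m′ → Subset m → Subset m′ → Set
NeighbourhoodSizeBijection {m} {m′} G H X X′ =
  ∃ λ (η : Subset m → Subset m′) →
    (∀ S → S ⊆ X → η S ⊆ X′) ×
    (∀ S S′ → S ⊆ X → S′ ⊆ X → η S ≡ η S′ → S ≡ S′) ×
    (∀ T → T ⊆ X′ → ∃ λ S → S ⊆ X × η S ≡ T) ×
    (∀ S → S ⊆ X → ∣ η S ∣ ≡ ∣ S ∣ × ∣ N H (η S) ∣ ≡ ∣ N G S ∣)

module _ {m} {A : Set} (G H : Graph m) (X : Subset m)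
         (enc : A → Subset m) (dec : Subset m → A)
         (enc⊆X : ∀ t → enc t ⊆ X)
         (dec∘enc : ∀ t → dec (enc t) ≡ t)
         (enc∘dec : ∀ S → S ⊆ X → enc (dec S) ≡ S) where

  transport-bijection : (φ : A ↔ A) → (∀ t → let t′ = Inverse.to φ t in
                          ∣ enc t′ ∣ ≡ ∣ enc t ∣ × ∣ N H (enc t′) ∣ ≡ ∣ N G (enc t) ∣) →
                        NeighbourhoodSizeBijection G H X X
  transport-bijection φ preserves = η , (λ S _ → enc⊆X _) , injective , surjective , sizes
    where
    open Inverse φ
    η : Subset m → Subset m
    η S = enc (to (dec S))
    injective : ∀ S S′ → S ⊆ X → S′ ⊆ X → η S ≡ η S′ → S ≡ S′
    injective S S′ S⊆X S′⊆X ηS≡ηS′ = begin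
      S                         ≡⟨ enc∘dec S S⊆X ⟨
      enc (dec S)               ≡⟨ cong enc (strictlyInverseʳ (dec S)) ⟨
      enc (from (to (dec S)))   ≡⟨ cong (enc ∘ from) to-dec-S≡to-dec-S′ ⟩
      enc (from (to (dec S′)))  ≡⟨ cong enc (strictlyInverseʳ (dec S′)) ⟩
      enc (dec S′)              ≡⟨ enc∘dec S′ S′⊆X ⟩
      S′                        ∎
      where
      open ≡-Reasoning
      to-dec-S≡to-dec-S′ : to (dec S) ≡ to (dec S′)
      to-dec-S≡to-dec-S′ = trans (sym (dec∘enc _)) (trans (cong dec ηS≡ηS′) (dec∘enc _))
    surjective : ∀ T → T ⊆ X → ∃ λ S → S ⊆ X × η S ≡ T
    surjective T T⊆X = enc (from (dec T)) , enc⊆X _ ,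
      trans (cong (enc ∘ to) (dec∘enc _)) (trans (cong enc (strictlyInverseˡ (dec T))) (enc∘dec T T⊆X))
    sizes : ∀ S → S ⊆ X → ∣ η S ∣ ≡ ∣ S ∣ × ∣ N H (η S) ∣ ≡ ∣ N G S ∣
    sizes S S⊆X =
      subst (λ S″ → ∣ η S ∣ ≡ ∣ S″ ∣ × ∣ N H (η S) ∣ ≡ ∣ N G S″ ∣) (enc∘dec S S⊆X) (preserves (dec S))

vertices-preserving : ∀ {n} (π₁ π₂ : Permutation′ n) {φ} → SizePreserving π₁ π₂ φ → ∀ t →
                      ∣ vertices (φ t) ∣ ≡ ∣ vertices t ∣ ×
                      ∣ N (Gπ π₂) (vertices (φ t)) ∣ ≡ ∣ N (Gπ π₁) (vertices t) ∣
vertices-preserving π₁ π₂ {φ} φ-preserving t =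
  trans (∣vertices∣ (φ t)) (trans (proj₁ (φ-preserving t)) (sym (∣vertices∣ t))) ,
  trans (∣N∣≡nsize π₂ (φ t)) (trans (proj₂ (φ-preserving t)) (sym (∣N∣≡nsize π₁ t)))

corollary19 : (n : ℕ) → 3 ≤ n → (π₁ π₂ : Permutation′ n) →
    fixedPoints π₁ ≡ fixedPoints π₂ → Gπ π₁ ≈ Gπ π₂
corollary19 n _ π₁ π₂ same-count =
  connected π₁ , connected π₂ , X n , X n , bipartite π₁ , bipartite π₂ ,
  ∣X∣≤∣∁X∣ n , ∣X∣≤∣∁X∣ n , refl , refl ,
  transport-bijection (Gπ π₁) (Gπ π₂) (X n) vertices parts vertices⊆X parts-vertices vertices-parts
    φ (vertices-preserving π₁ π₂ φ-preserving)
  where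
  φ : XSubset n ↔ XSubset n
  φ = proj₁ (xsubset-bijection π₁ π₂ same-count)
  φ-preserving : SizePreserving π₁ π₂ (Inverse.to φ)
  φ-preserving = proj₂ (xsubset-bijection π₁ π₂ same-count)
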